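{- Let $T$ be a tournament and $u,v\in V(T)$. Then $v$ is the captain of $u$ in $T$ if and only if $\{v\}$ is the unique minimal $\tau$-retentive set of $T[N^-_T(u)]$. Moreover, if $v$ is the captain of $u$ and $u$ belongs to a minimal $\tau$-retentive set $R$ of $T$, then $v\in R$.
   Context: A tournament $T$ consists of a finite vertex set $V(T)$ and an asymmetric, complete binary relation $\succ$ on $V(T)$ ($x$ dominates $y$ if $x\succ y$). For $v\in V(T)$ let $N^-_T(v)=\{u: u\succ v\}$; for $B\subseteq V(T)$, $T[B]$ is the induced subtournament. A vertex $v$ is the captain of a vertex $u$ in $T$ if $v\succ u$ and $v\succ w$ for every $w\in N^-_T(u)\setminus\{v\}$. The tournament equilibrium set $\tau$ is defined recursively: a nonempty $A\subseteq V(T)$ is $\tau$-retentive if for every $x\in A$ with $N^-_T(x)\neq\emptyset$, $\tau(T[N^-_T(x)])\subseteq A$; $A$ is a minimal $\tau$-retentive set if no $\tau$-retentive set of $T$ is a proper subset of $A$; $\tau(T)$ is the union of all minimal $\tau$-retentive sets of $T$. -}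

module Defs where

open import Data.Nat using (ℕ; zero; suc)
open import Data.Bool using (Bool; true; false; T)
open import Data.Fin using (Fin)
open import Data.Fin.Subset using (Subset; _∈_; _⊆_; _∩_; ∣_∣; Nonempty; ⊤; ⁅_⁆)
open import Data.Vec using (tabulate)
open import Data.Product using (Σ; _×_)
open import Data.Sum using (_⊎_)
open import Data.Empty using (⊥)
open import Relation.Binary.PropositionalEquality using (_≡_; _≢_)

record Tournament (n : ℕ) : Set where
  field
    beats    : Fin n → Fin n → Bool
    asym     : ∀ x y → T (beats x y) → T (beats y x) → ⊥
    complete : ∀ x y → x ≢ y → T (beats x y) ⊎ T (beats y x)

module _ {n : ℕ} (Tn : Tournament n) where
  open Tournament Tn

  _≻_ : Fin n → Fin n → Set
  x ≻ y = T (beats x y)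

  -- N^-_T(x) as a subset of V(T) = Fin n.  For B ⊆ V(T),
  -- N^-_{T[B]}(x) = N^-_T(x) ∩ B.
  InNbhd : Fin n → Subset n
  InNbhd x = tabulate (λ y → beats y x)

  Captain : Fin n → Fin n → Set
  Captain v u = (v ≻ u) × (∀ w → w ≻ u → w ≢ v → v ≻ w)

  -- Recursive definition of τ on induced subtournaments T[B], with a fuel
  -- parameter k (used with k ≥ |B|; the recursion is on the strictly
  -- smaller sets N^-_{T[B]}(x)).  τ-fuel k B x  means  x ∈ τ(T[B]).
  mutual
    τ-fuel : ℕ → Subset n → Fin n → Set
    τ-fuel zero    B x = ⊥
    τ-fuel (suc k) B x = Σ (Subset n) λ A → MinRetentive-fuel k B A × x ∈ A

    Retentive-fuel : ℕ → Subset n → Subset n → Set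
    Retentive-fuel k B A =
      Nonempty A × A ⊆ B ×
      (∀ x → x ∈ A → Nonempty (InNbhd x ∩ B) →
         ∀ y → τ-fuel k (InNbhd x ∩ B) y → y ∈ A)

    MinRetentive-fuel : ℕ → Subset n → Subset n → Set
    MinRetentive-fuel k B A =
      Retentive-fuel k B A ×
      (∀ A' → Retentive-fuel k B A' → A' ⊆ A → A ⊆ A')

  -- Fuel fixed to |B| (enough: every set N^-_{T[B]}(x), x ∈ B, has size < |B|).
  Retentive : Subset n → Subset n → Set
  Retentive B A = Retentive-fuel ∣ B ∣ B A

  MinRetentive : Subset n → Subset n → Set
  MinRetentive B A = MinRetentive-fuel ∣ B ∣ B A

  τ : Subset n → Fin n → Set
  τ B x = τ-fuel (suc ∣ B ∣) B x

  UniqueMinRetentiveSingleton : Subset n → Fin n → Set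
  UniqueMinRetentiveSingleton B v =
    MinRetentive B ⁅ v ⁆ × (∀ A → MinRetentive B A → A ≡ ⁅ v ⁆)

-- A captain v of u beats every other in-neighbour of u, i.e. it is the Condorcet
-- winner of T[N⁻(u)].  A Condorcet winner of T[B] forms a τ-retentive singleton on
-- its own (nothing in B beats it), and it lies in every τ-retentive set A of T[B]:
-- any a ∈ A other than v is beaten by v, and v is again the Condorcet winner of
-- T[N⁻(a) ∩ B], hence in its τ.  Conversely, if {v} is τ-retentive then nothing in
-- B beats v, since otherwise τ of the nonempty T[N⁻(v) ∩ B] would have to lie in {v}.
-- The last claim is the absorption argument applied to T itself at a = u.
module Submission where

open import Defs hiding (_≻_)
import Defs
open import Data.Nat using (ℕ; suc; _<_; NonZero; ≢-nonZero)
open import Data.Nat.Properties using (m<n⇒n≢0)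
open import Data.Nat.Induction using (<-wellFounded)
open import Data.Fin using (Fin)
open import Data.Fin.Properties using (_≟_)
open import Data.Fin.Subset using (Subset; _∈_; ⊤; _⊆_; _∩_; ∣_∣; Nonempty; ⁅_⁆)
open import Data.Fin.Subset.Properties
  using (_∈?_; ∈⊤; x∈⁅x⁆; x∈⁅y⁆⇒x≡y; x∈p∩q⁺; x∈p∩q⁻; ⊆-antisym; p⊂q⇒∣p∣<∣q∣; x∈p⇒∣p-x∣<∣p∣)
open import Data.Product using (_×_; _,_; proj₁; proj₂)
open import Data.Sum using (inj₁; inj₂)
open import Data.Empty using (⊥-elim)
open import Data.Bool.Properties using (T-≡)
open import Data.Vec.Properties using (lookup⇒[]=; []=⇒lookup; lookup∘tabulate)
open import Function using (_∘_; case_of_; Equivalence)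
open import Induction.WellFounded using (Acc; acc)
open import Relation.Nullary using (¬_; yes; no)
open import Relation.Binary.PropositionalEquality using (_≡_; _≢_; refl; sym; trans; subst)

∈⇒nonZero-∣∣ : ∀ {n} {x : Fin n} {p : Subset n} → x ∈ p → NonZero ∣ p ∣
∈⇒nonZero-∣∣ = ≢-nonZero ∘ m<n⇒n≢0 ∘ x∈p⇒∣p-x∣<∣p∣

∈⁅⁆⇒⁅⁆⊆ : ∀ {n} {x : Fin n} {p : Subset n} → x ∈ p → ⁅ x ⁆ ⊆ p
∈⁅⁆⇒⁅⁆⊆ {x = x} x∈p y∈⁅x⁆ = subst (_∈ _) (sym (x∈⁅y⁆⇒x≡y x y∈⁅x⁆)) x∈p

module _ {n : ℕ} (Tn : Tournament n) where
  open Tournament Tn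

  infix 4 _≻_
  _≻_ : Fin n → Fin n → Set
  x ≻ y = Defs._≻_ Tn x y

  ≻⇒≢ : ∀ {x y} → x ≻ y → x ≢ y
  ≻⇒≢ x≻y refl = asym _ _ x≻y x≻y

  ∈InNbhd⁺ : ∀ {x y} → x ≻ y → x ∈ InNbhd Tn y
  ∈InNbhd⁺ {x} {y} x≻y =
    lookup⇒[]= x _ (trans (lookup∘tabulate (λ z → beats z y) x) (Equivalence.to T-≡ x≻y))

  ∈InNbhd⁻ : ∀ {x y} → x ∈ InNbhd Tn y → x ≻ y
  ∈InNbhd⁻ {x} {y} x∈ =
    Equivalence.from T-≡ (trans (sym (lookup∘tabulate (λ z → beats z y) x)) ([]=⇒lookup x∈))

  IsCondorcetWinner : Subset n → Fin n → Set
  IsCondorcetWinner B v = v ∈ B × (∀ w → w ∈ B → w ≢ v → v ≻ w)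

  condorcetWinner-⊆ : ∀ {B C v} → IsCondorcetWinner B v → C ⊆ B → v ∈ C → IsCondorcetWinner C v
  condorcetWinner-⊆ (_ , v≻B) C⊆B v∈C = v∈C , λ w w∈C → v≻B w (C⊆B w∈C)

  condorcetWinner-unbeaten : ∀ {B v w} → IsCondorcetWinner B v → w ∈ B → ¬ w ≻ v
  condorcetWinner-unbeaten (_ , v≻B) w∈B w≻v = asym _ _ w≻v (v≻B _ w∈B (≻⇒≢ w≻v))

  unbeaten⇒condorcetWinner : ∀ {B v} → v ∈ B → (∀ {w} → w ∈ B → ¬ w ≻ v) → IsCondorcetWinner B v
  unbeaten⇒condorcetWinner {v = v} v∈B unbeaten = v∈B , λ w w∈B w≢v → case complete w v w≢v of λ where
    (inj₁ w≻v) → ⊥-elim (unbeaten w∈B w≻v)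
    (inj₂ v≻w) → v≻w

  captain⇒condorcetWinner : ∀ {u v} → Captain Tn v u → IsCondorcetWinner (InNbhd Tn u) v
  captain⇒condorcetWinner (v≻u , v≻N⁻u) = ∈InNbhd⁺ v≻u , λ w → v≻N⁻u w ∘ ∈InNbhd⁻

  condorcetWinner⇒captain : ∀ {u v} → IsCondorcetWinner (InNbhd Tn u) v → Captain Tn v u
  condorcetWinner⇒captain (v∈N⁻u , v≻N⁻u) = ∈InNbhd⁻ v∈N⁻u , λ w → v≻N⁻u w ∘ ∈InNbhd⁺

  τ-fuel-⊆ : ∀ k {B y} → τ-fuel Tn k B y → y ∈ B
  τ-fuel-⊆ (suc k) (A , ((_ , A⊆B , _) , _) , y∈A) = A⊆B y∈A

  retentive-self : ∀ k {C} → Nonempty C → Retentive-fuel Tn k C C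
  retentive-self k C≢∅ = C≢∅ , (λ y∈C → y∈C) , λ x _ _ y y∈τ → proj₂ (x∈p∩q⁻ _ _ (τ-fuel-⊆ k y∈τ))

  -- Doubly negated because τ-retentiveness is not decidable: descent on cardinality
  -- only refutes the absence of a minimal τ-retentive set.
  minRetentive-exists : ∀ k {C} → Nonempty C → ¬ (∀ A → ¬ MinRetentive-fuel Tn k C A)
  minRetentive-exists k {C} C≢∅ = below (<-wellFounded ∣ C ∣) (retentive-self k C≢∅)
    where
    below : ∀ {A} → Acc _<_ ∣ A ∣ → Retentive-fuel Tn k C A → ¬ (∀ A → ¬ MinRetentive-fuel Tn k C A)
    below {A} (acc smaller) A-ret none = none A (A-ret , minimal)
      where
      minimal : ∀ A' → Retentive-fuel Tn k C A' → A' ⊆ A → A ⊆ A'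
      minimal A' A'-ret A'⊆A {x} x∈A with x ∈? A'
      ... | yes x∈A' = x∈A'
      ... | no  x∉A' = ⊥-elim (below (smaller (p⊂q⇒∣p∣<∣q∣ (A'⊆A , x , x∈A , x∉A'))) A'-ret none)

  τ-fuel-nonempty : ∀ k .{{_ : NonZero k}} {C} → Nonempty C → ¬ (∀ y → ¬ τ-fuel Tn k C y)
  τ-fuel-nonempty (suc k) C≢∅ no-τ =
    minRetentive-exists k C≢∅ λ { A m@(((a , a∈A) , _) , _) → no-τ a (A , m , a∈A) }

  condorcetWinner⇒minRetentive-⁅⁆ : ∀ k {B v} → IsCondorcetWinner B v → MinRetentive-fuel Tn k B ⁅ v ⁆
  condorcetWinner⇒minRetentive-⁅⁆ k {B} {v} win@(v∈B , _) =
    ((v , x∈⁅x⁆ v) , ∈⁅⁆⇒⁅⁆⊆ v∈B , retentive) , minimal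
    where
    retentive : ∀ x → x ∈ ⁅ v ⁆ → Nonempty (InNbhd Tn x ∩ B) →
                ∀ y → τ-fuel Tn k (InNbhd Tn x ∩ B) y → y ∈ ⁅ v ⁆
    retentive x x∈⁅v⁆ (w , w∈) with refl ← x∈⁅y⁆⇒x≡y v x∈⁅v⁆ =
      ⊥-elim (condorcetWinner-unbeaten win (proj₂ (x∈p∩q⁻ _ _ w∈)) (∈InNbhd⁻ (proj₁ (x∈p∩q⁻ _ _ w∈))))
    minimal : ∀ A → Retentive-fuel Tn k B A → A ⊆ ⁅ v ⁆ → ⁅ v ⁆ ⊆ A
    minimal A ((a , a∈A) , _) A⊆⁅v⁆ = ∈⁅⁆⇒⁅⁆⊆ (subst (_∈ A) (x∈⁅y⁆⇒x≡y v (A⊆⁅v⁆ a∈A)) a∈A)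

  condorcetWinner⇒τ-fuel : ∀ k .{{_ : NonZero k}} {B v} → IsCondorcetWinner B v → τ-fuel Tn k B v
  condorcetWinner⇒τ-fuel (suc k) {v = v} win = ⁅ v ⁆ , condorcetWinner⇒minRetentive-⁅⁆ k win , x∈⁅x⁆ v

  retentive-∋-condorcetWinner : ∀ k .{{_ : NonZero k}} {B A x v} → Retentive-fuel Tn k B A → x ∈ A →
                                IsCondorcetWinner (InNbhd Tn x ∩ B) v → v ∈ A
  retentive-∋-condorcetWinner k (_ , _ , retentive) x∈A win@(v∈ , _) =
    retentive _ x∈A (_ , v∈) _ (condorcetWinner⇒τ-fuel k win)

  condorcetWinner∈retentive : ∀ k .{{_ : NonZero k}} {B A v} → IsCondorcetWinner B v →
                              Retentive-fuel Tn k B A → v ∈ A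
  condorcetWinner∈retentive k {v = v} win@(v∈B , v≻B) A-ret@((a , a∈A) , A⊆B , _) with a ≟ v
  ... | yes refl = a∈A
  ... | no  a≢v  = retentive-∋-condorcetWinner k A-ret a∈A
        (condorcetWinner-⊆ win (proj₂ ∘ x∈p∩q⁻ _ _) (x∈p∩q⁺ (∈InNbhd⁺ (v≻B a (A⊆B a∈A) a≢v) , v∈B)))

  condorcetWinner⇒minRetentive≡⁅⁆ : ∀ k .{{_ : NonZero k}} {B A v} → IsCondorcetWinner B v →
                                    MinRetentive-fuel Tn k B A → A ≡ ⁅ v ⁆
  condorcetWinner⇒minRetentive≡⁅⁆ k win (A-ret , minimal) =
    ⊆-antisym (minimal _ (proj₁ (condorcetWinner⇒minRetentive-⁅⁆ k win)) ⁅v⁆⊆A) ⁅v⁆⊆A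
    where ⁅v⁆⊆A = ∈⁅⁆⇒⁅⁆⊆ (condorcetWinner∈retentive k win A-ret)

  retentive-⁅⁆⇒condorcetWinner : ∀ k .{{_ : NonZero k}} {B v} → Retentive-fuel Tn k B ⁅ v ⁆ →
                                 IsCondorcetWinner B v
  retentive-⁅⁆⇒condorcetWinner k {B} {v} (_ , ⁅v⁆⊆B , retentive) =
    unbeaten⇒condorcetWinner (⁅v⁆⊆B (x∈⁅x⁆ v)) λ w∈B w≻v →
      let w∈N⁻v∩B = x∈p∩q⁺ (∈InNbhd⁺ w≻v , w∈B)
          τ⊆⁅v⁆ : ∀ y → τ-fuel Tn k (InNbhd Tn v ∩ B) y → y ≡ v
          τ⊆⁅v⁆ y y∈τ = x∈⁅y⁆⇒x≡y v (retentive v (x∈⁅x⁆ v) (_ , w∈N⁻v∩B) y y∈τ)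
      in τ-fuel-nonempty k (_ , w∈N⁻v∩B) λ y y∈τ →
           ≻⇒≢ (∈InNbhd⁻ (proj₁ (x∈p∩q⁻ _ _ (τ-fuel-⊆ k y∈τ)))) (τ⊆⁅v⁆ y y∈τ)

lemma4 : ∀ {n : ℕ} (Tn : Tournament n) (u v : Fin n) →
    ((Captain Tn v u → UniqueMinRetentiveSingleton Tn (InNbhd Tn u) v) ×
     (UniqueMinRetentiveSingleton Tn (InNbhd Tn u) v → Captain Tn v u)) ×
    (∀ (R : Subset n) → Captain Tn v u → MinRetentive Tn ⊤ R → u ∈ R → v ∈ R)
lemma4 {n} Tn u v = (captain⇒unique , unique⇒captain) , captain∈minRetentive
  where
  N⁻u = InNbhd Tn u

  captain⇒unique : Captain Tn v u → UniqueMinRetentiveSingleton Tn N⁻u v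
  captain⇒unique captain =
    condorcetWinner⇒minRetentive-⁅⁆ Tn ∣ N⁻u ∣ win ,
    λ A → condorcetWinner⇒minRetentive≡⁅⁆ Tn ∣ N⁻u ∣ {{∈⇒nonZero-∣∣ (proj₁ win)}} win
    where win = captain⇒condorcetWinner Tn captain

  unique⇒captain : UniqueMinRetentiveSingleton Tn N⁻u v → Captain Tn v u
  unique⇒captain ((⁅v⁆-ret@(_ , ⁅v⁆⊆N⁻u , _) , _) , _) =
    condorcetWinner⇒captain Tn
      (retentive-⁅⁆⇒condorcetWinner Tn ∣ N⁻u ∣ {{∈⇒nonZero-∣∣ (⁅v⁆⊆N⁻u (x∈⁅x⁆ v))}} ⁅v⁆-ret)

  captain∈minRetentive : ∀ R → Captain Tn v u → MinRetentive Tn ⊤ R → u ∈ R → v ∈ R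
  captain∈minRetentive R captain (R-ret , _) u∈R =
    retentive-∋-condorcetWinner Tn ∣ ⊤ {n} ∣ {{∈⇒nonZero-∣∣ (∈⊤ {x = u})}} R-ret u∈R
      (condorcetWinner-⊆ Tn (captain⇒condorcetWinner Tn captain) (proj₁ ∘ x∈p∩q⁻ _ _)
        (x∈p∩q⁺ (∈InNbhd⁺ Tn (proj₁ captain) , ∈⊤)))
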